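{- Let $\vec{x}$ and $\vec{a}$ be disjoint lists of Boolean variables and let $\mathcal{S}(\vec{x},\vec{a})$ be a specification over $\vec{a}$. Let $\alpha$ be any assignment of the variables $\vec{x}$. Then $\alpha$ can be extended to an assignment $\beta$ (of the variables $\vec{x}$ and $\vec{a}$) such that (1) $\beta$ satisfies $\mathcal{S}$, and (2) $\alpha(x)=\beta(x)$ for every $x\in\vec{x}$.
   Context: Boolean variables take values in $\{0,1\}$; a literal is a variable $x$ or its negation $\bar{x}=1-x$. A pseudo-Boolean (PB) constraint is an integer linear inequality $C \doteq \sum_i a_i\ell_i\ge A$ over literals; its negation is $\neg C\doteq\sum_i a_i\bar{\ell}_i\ge \sum_i a_i-A+1$. A PB formula is a finite set (conjunction) of PB constraints. A substitution (witness) $\omega$ maps variables to $\{0,1\}$ or to literals, and is extended by $\omega(\bar{x})=\overline{\omega(x)}$, $\omega(0)=0$, $\omega(1)=1$; its support is $\mathrm{supp}(\omega)=\{x:\omega(x)\neq x\}$. For a constraint $C$, $C\!\upharpoonright_\omega$ is obtained by replacing each literal $\ell$ by $\omega(\ell)$, and $F\!\upharpoonright_\omega=\{C\!\upharpoonright_\omega: C\in F\}$. For PB formulas $F,G$, $F\vdash G$ means every constraint of $G$ has a cutting planes derivation from $F$ (cutting planes is a sound proof system for PB constraints; in particular every assignment satisfying $F$ satisfies $G$). A PB formula $\mathcal{S}(\vec{x},\vec{a})=\{C_1,\dots,C_m\}$ is a specification over $\vec{a}$ if there are substitutions $\omega_1,\dots,\omega_m$ with $\mathrm{supp}(\omega_i)\subseteq\vec{a}$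 for all $i$ such that for each $i\in\{1,\dots,m\}$, $\{C_1,\dots,C_{i-1}\}\cup\{\neg C_i\}\vdash\{C_1,\dots,C_i\}\!\upharpoonright_{\omega_i}$ (i.e., each $C_i$ can be added to $\{C_1,\dots,C_{i-1}\}$ by the redundance rule with witness $\omega_i$ under the trivial order). -}

module Defs where

open import Data.Nat as ℕ using (ℕ; NonZero)
open import Data.Integer as ℤ using (ℤ; +_; _+_; _-_; -_; _*_; _≤_; 0ℤ; 1ℤ; -1ℤ; _/ℕ_)
open import Data.Bool using (Bool; true; false; if_then_else_)
open import Data.Fin using (Fin)
open import Data.Fin.Subset using (Subset; _∉_)
open import Data.Vec using (Vec; replicate; zipWith; map; _[_]≔_)
open import Data.List as List using (List; []; _∷_; _++_; length; take; lookup; foldr)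
open import Data.List.Membership.Propositional using (_∈_)
open import Data.List.Relation.Unary.All using (All)
open import Data.Product using (_×_; _,_; Σ; ∃)
open import Relation.Binary.PropositionalEquality using (_≡_)

data Lit (n : ℕ) : Set where
  pos : Fin n → Lit n
  neg : Fin n → Lit n

record PB (n : ℕ) : Set where
  constructor _≥ᵖᵇ_
  field
    terms  : List (ℤ × Lit n)
    degree : ℤ
open PB public

Formula : ℕ → Set
Formula n = List (PB n)

Assignment : ℕ → Set
Assignment n = Fin n → Bool

b2z : Bool → ℤ
b2z true  = 1ℤ
b2z false = 0ℤ

evalLit : ∀ {n} → Assignment n → Lit n → ℤ
evalLit β (pos x) = b2z (β x)
evalLit β (neg x) = 1ℤ - b2z (β x)

lhs : ∀ {n} → Assignment n → List (ℤ × Lit n) → ℤ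
lhs β []            = 0ℤ
lhs β ((a , ℓ) ∷ ts) = a * evalLit β ℓ + lhs β ts

Sat : ∀ {n} → Assignment n → PB n → Set
Sat β C = degree C ≤ lhs β (terms C)

SatF : ∀ {n} → Assignment n → Formula n → Set
SatF β F = All (Sat β) F

negLit : ∀ {n} → Lit n → Lit n
negLit (pos x) = neg x
negLit (neg x) = pos x

sumCoeffs : ∀ {n} → List (ℤ × Lit n) → ℤ
sumCoeffs []            = 0ℤ
sumCoeffs ((a , _) ∷ ts) = a + sumCoeffs ts

negTerms : ∀ {n} → List (ℤ × Lit n) → List (ℤ × Lit n)
negTerms []            = []
negTerms ((a , ℓ) ∷ ts) = (a , negLit ℓ) ∷ negTerms ts

negPB : ∀ {n} → PB n → PB n
negPB C = negTerms (terms C) ≥ᵖᵇ (sumCoeffs (terms C) - degree C + 1ℤ)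

data Val (n : ℕ) : Set where
  const : Bool → Val n
  lit   : Lit n → Val n

Subst : ℕ → Set
Subst n = Fin n → Val n

notVal : ∀ {n} → Val n → Val n
notVal (const b) = const (if b then false else true)
notVal (lit ℓ)   = lit (negLit ℓ)

substLit : ∀ {n} → Subst n → Lit n → Val n
substLit ω (pos x) = ω x
substLit ω (neg x) = notVal (ω x)

SuppIn : ∀ {n} → Subst n → Subset n → Set
SuppIn ω A = ∀ x → x ∉ A → ω x ≡ lit (pos x)

substTerms : ∀ {n} → Subst n → List (ℤ × Lit n) → List (ℤ × Lit n) × ℤ
substTerms ω [] = [] , 0ℤ
substTerms ω ((a , ℓ) ∷ ts) with substTerms ω ts | substLit ω ℓ
... | ts' , k | const true  = ts' , a + k
... | ts' , k | const false = ts' , k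
... | ts' , k | lit ℓ'      = (a , ℓ') ∷ ts' , k

substPB : ∀ {n} → Subst n → PB n → PB n
substPB ω C with substTerms ω (terms C)
... | ts , k = ts ≥ᵖᵇ (degree C - k)

substF : ∀ {n} → Subst n → Formula n → Formula n
substF ω F = List.map (substPB ω) F

-- Constraints are normalised to linear forms over the
-- variables,  Σ_j c_j x_j ≥ d  (using x̄ = 1 − x), and derived with the
-- usual rules: axioms, literal axioms (x ≥ 0, x̄ ≥ 0), addition,
-- multiplication by a natural number, division (with rounding up).

record Lin (n : ℕ) : Set where
  constructor lin
  field
    coeffs : Vec ℤ n
    rhs    : ℤ
open Lin public

normTerms : ∀ {n} → List (ℤ × Lit n) → Vec ℤ n × ℤ
normTerms {n} [] = replicate n 0ℤ , 0ℤ
normTerms ((a , pos x) ∷ ts) with normTerms ts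
... | v , k = (v [ x ]≔ (Data.Vec.lookup v x + a)) , k
normTerms ((a , neg x) ∷ ts) with normTerms ts
... | v , k = (v [ x ]≔ (Data.Vec.lookup v x - a)) , k + a

norm : ∀ {n} → PB n → Lin n
norm C with normTerms (terms C)
... | v , k = lin v (degree C - k)

unit : ∀ {n} → Fin n → ℤ → Vec ℤ n
unit {n} x c = replicate n 0ℤ [ x ]≔ c

ceilDiv : ℤ → (c : ℕ) → .{{NonZero c}} → ℤ
ceilDiv d c = - ((- d) /ℕ c)

data CP {n : ℕ} (F : Formula n) : Lin n → Set where
  axiom  : ∀ {C} → C ∈ F → CP F (norm C)
  litPos : ∀ x → CP F (lin (unit x 1ℤ) 0ℤ)
  litNeg : ∀ x → CP F (lin (unit x -1ℤ) -1ℤ)      -- x̄ ≥ 0, i.e. −x ≥ −1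
  add    : ∀ {L M} → CP F L → CP F M →
           CP F (lin (zipWith _+_ (coeffs L) (coeffs M)) (rhs L + rhs M))
  mul    : ∀ {L} (c : ℕ) → CP F L →
           CP F (lin (map (+ c *_) (coeffs L)) (+ c * rhs L))
  div    : ∀ {L} (c : ℕ) .{{_ : NonZero c}} (g : Vec ℤ n) →
           coeffs L ≡ map (+ c *_) g → CP F L →
           CP F (lin g (ceilDiv (rhs L) c))

-- F ⊢ C : C (or a trivial weakening of it) has a cutting planes derivation from F.
_⊢₁_ : ∀ {n} → Formula n → PB n → Set
F ⊢₁ C = Σ ℤ λ d → (rhs (norm C) ≤ d) × CP F (lin (coeffs (norm C)) d)

_⊢_ : ∀ {n} → Formula n → Formula n → Set
F ⊢ G = All (F ⊢₁_) G

IsSpecification : ∀ {n} → Formula n → Subset n → Set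
IsSpecification {n} S A =
  (i : Fin (length S)) →
  Σ (Subst n) λ ω →
    SuppIn ω A ×
    ((take (Data.Fin.toℕ i) S ++ (negPB (lookup S i) ∷ [])) ⊢
       substF ω (take (ℕ.suc (Data.Fin.toℕ i)) S))

-- Add the constraints of S one at a time, keeping an assignment that agrees
-- with α outside A and satisfies the constraints added so far.  If it
-- already satisfies the next constraint C_i nothing changes.  Otherwise it
-- satisfies ¬C_i, so by soundness of cutting planes it satisfies
-- {C_1,…,C_i}↾ω_i; composing it with ω_i therefore satisfies C_1,…,C_i, and
-- since ω_i only moves variables of A the agreement with α is preserved.
module Submission where

open import Defs
open import Data.Nat using (ℕ)
open import Data.Fin using (Fin)
open import Data.Fin.Subset using (Subset; _∉_)
open import Data.Product using (Σ; _×_; _,_; proj₁; proj₂)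
open import Relation.Binary.PropositionalEquality
  using (_≡_; refl; sym; trans; cong; cong₂; subst; module ≡-Reasoning)

import Data.Nat as ℕ
import Data.Nat.Properties as ℕ
open import Data.Integer
  using (ℤ; +_; _+_; _-_; -_; _*_; _≤_; _<_; 0ℤ; 1ℤ; -1ℤ; _/ℕ_; _≤?_; +≤+; -≤+)
open import Data.Integer.Properties
open import Data.Integer.DivMod using (n<s[n/ℕd]*d)
open import Data.Integer.Tactic.RingSolver using (solve-∀)
open import Data.Bool using (Bool; true; false; not)
open import Data.Bool.Properties using (not-involutive)
open import Data.Fin using (zero; suc; toℕ; fromℕ<)
open import Data.Fin.Properties using (toℕ-fromℕ<)
open import Data.Vec using (Vec; []; _∷_; replicate; zipWith; map; _[_]≔_)
import Data.Vec as Vec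
open import Data.List using ([]; _∷_; _++_; length; take; lookup)
open import Data.List.Properties using (take-suc; take-all)
open import Data.List.Relation.Unary.All as All using ([]; _∷_)
open import Data.List.Relation.Unary.All.Properties using (++⁺)
open import Relation.Nullary using (yes; no; ¬_)
open import Relation.Nullary.Negation using (contradiction)
open import Function using (_∘_)

open ≡-Reasoning

0≤b2z : ∀ b → 0ℤ ≤ b2z b
0≤b2z true  = +≤+ ℕ.z≤n
0≤b2z false = +≤+ ℕ.z≤n

-1≤-b2z : ∀ b → -1ℤ ≤ -1ℤ * b2z b
-1≤-b2z true  = ≤-refl
-1≤-b2z false = -≤+

b2z-not : ∀ b → b2z (not b) ≡ 1ℤ - b2z b
b2z-not true  = refl
b2z-not false = refl

d≤x+k⇒d-k≤x : ∀ {d x} k → d ≤ x + k → d - k ≤ x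
d≤x+k⇒d-k≤x {d} {x} k d≤x+k =
  subst (d - k ≤_) (cancel x k) (+-monoˡ-≤ (- k) d≤x+k)
  where
  cancel : ∀ x k → (x + k) - k ≡ x
  cancel = solve-∀

d-k≤x⇒d≤x+k : ∀ {d x} k → d - k ≤ x → d ≤ x + k
d-k≤x⇒d≤x+k {d} {x} k d-k≤x =
  subst (_≤ x + k) (cancel d k) (+-monoˡ-≤ k d-k≤x)
  where
  cancel : ∀ d k → (d - k) + k ≡ d
  cancel = solve-∀

dot : ∀ {n} → Vec ℤ n → Assignment n → ℤ
dot []      β = 0ℤ
dot (c ∷ v) β = c * b2z (β zero) + dot v (β ∘ suc)

dot-replicate-0 : ∀ n (β : Assignment n) → dot (replicate n 0ℤ) β ≡ 0ℤ
dot-replicate-0 ℕ.zero    β = refl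
dot-replicate-0 (ℕ.suc n) β =
  cong₂ _+_ (*-zeroˡ (b2z (β zero))) (dot-replicate-0 n (β ∘ suc))

dot-update : ∀ {n} (v : Vec ℤ n) x a (β : Assignment n) →
             dot (v [ x ]≔ (Vec.lookup v x + a)) β ≡ dot v β + a * b2z (β x)
dot-update (c ∷ v) zero    a β = rearrange c a (b2z (β zero)) (dot v (β ∘ suc))
  where
  rearrange : ∀ c a b d → (c + a) * b + d ≡ (c * b + d) + a * b
  rearrange = solve-∀
dot-update (c ∷ v) (suc x) a β = begin
  c * b2z (β zero) + dot (v [ x ]≔ (Vec.lookup v x + a)) (β ∘ suc)
    ≡⟨ cong (_+_ (c * b2z (β zero))) (dot-update v x a (β ∘ suc)) ⟩
  c * b2z (β zero) + (dot v (β ∘ suc) + a * b2z (β (suc x)))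
    ≡⟨ sym (+-assoc (c * b2z (β zero)) (dot v (β ∘ suc)) (a * b2z (β (suc x)))) ⟩
  dot (c ∷ v) β + a * b2z (β (suc x)) ∎

dot-unit : ∀ {n} x c (β : Assignment n) → dot (unit x c) β ≡ c * b2z (β x)
dot-unit {ℕ.suc n} zero c β = begin
  c * b2z (β zero) + dot (replicate n 0ℤ) (β ∘ suc)
    ≡⟨ cong (_+_ (c * b2z (β zero))) (dot-replicate-0 n (β ∘ suc)) ⟩
  c * b2z (β zero) + 0ℤ
    ≡⟨ +-identityʳ _ ⟩
  c * b2z (β zero) ∎
dot-unit {ℕ.suc n} (suc x) c β = begin
  0ℤ * b2z (β zero) + dot (unit x c) (β ∘ suc)
    ≡⟨ cong₂ _+_ (*-zeroˡ (b2z (β zero))) (dot-unit x c (β ∘ suc)) ⟩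
  0ℤ + c * b2z (β (suc x))
    ≡⟨ +-identityˡ _ ⟩
  c * b2z (β (suc x)) ∎

dot-zipWith-+ : ∀ {n} (u v : Vec ℤ n) β → dot (zipWith _+_ u v) β ≡ dot u β + dot v β
dot-zipWith-+ []      []      β = refl
dot-zipWith-+ (a ∷ u) (b ∷ v) β = begin
  (a + b) * x + dot (zipWith _+_ u v) (β ∘ suc)
    ≡⟨ cong₂ _+_ (*-distribʳ-+ x a b) (dot-zipWith-+ u v (β ∘ suc)) ⟩
  (a * x + b * x) + (dot u (β ∘ suc) + dot v (β ∘ suc))
    ≡⟨ interchange (a * x) (b * x) _ _ ⟩
  dot (a ∷ u) β + dot (b ∷ v) β ∎
  where
  x = b2z (β zero)
  interchange : ∀ p q r s → (p + q) + (r + s) ≡ (p + r) + (q + s)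
  interchange = solve-∀

dot-map-* : ∀ {n} c (v : Vec ℤ n) β → dot (map (c *_) v) β ≡ c * dot v β
dot-map-* c []      β = sym (*-zeroʳ c)
dot-map-* c (a ∷ v) β = begin
  c * a * x + dot (map (c *_) v) (β ∘ suc)
    ≡⟨ cong₂ _+_ (*-assoc c a x) (dot-map-* c v (β ∘ suc)) ⟩
  c * (a * x) + c * dot v (β ∘ suc)
    ≡⟨ sym (*-distribˡ-+ c (a * x) _) ⟩
  c * dot (a ∷ v) β ∎
  where x = b2z (β zero)

SatLin : ∀ {n} → Assignment n → Lin n → Set
SatLin β L = rhs L ≤ dot (coeffs L) β

lhs≡dot-normTerms : ∀ {n} (β : Assignment n) ts →
                    lhs β ts ≡ dot (proj₁ (normTerms ts)) β + proj₂ (normTerms ts)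
lhs≡dot-normTerms {n} β [] = sym (trans (+-identityʳ _) (dot-replicate-0 n β))
lhs≡dot-normTerms β ((a , pos x) ∷ ts) with normTerms ts | lhs≡dot-normTerms β ts
... | v , k | ih = begin
  a * b2z (β x) + lhs β ts     ≡⟨ cong (_+_ (a * b2z (β x))) ih ⟩
  a * b2z (β x) + (dot v β + k) ≡⟨ rearrange (a * b2z (β x)) (dot v β) k ⟩
  (dot v β + a * b2z (β x)) + k ≡⟨ cong (_+ k) (sym (dot-update v x a β)) ⟩
  dot (v [ x ]≔ (Vec.lookup v x + a)) β + k ∎
  where
  rearrange : ∀ e d k → e + (d + k) ≡ (d + e) + k
  rearrange = solve-∀
lhs≡dot-normTerms β ((a , neg x) ∷ ts) with normTerms ts | lhs≡dot-normTerms β ts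
... | v , k | ih = begin
  a * (1ℤ - b2z (β x)) + lhs β ts          ≡⟨ cong (_+_ (a * (1ℤ - b2z (β x)))) ih ⟩
  a * (1ℤ - b2z (β x)) + (dot v β + k)      ≡⟨ rearrange a (b2z (β x)) (dot v β) k ⟩
  (dot v β + - a * b2z (β x)) + (k + a)     ≡⟨ cong (_+ (k + a)) (sym (dot-update v x (- a) β)) ⟩
  dot (v [ x ]≔ (Vec.lookup v x - a)) β + (k + a) ∎
  where
  rearrange : ∀ a b d k → a * (1ℤ - b) + (d + k) ≡ (d + - a * b) + (k + a)
  rearrange = solve-∀

Sat⇒SatLin-norm : ∀ {n} (β : Assignment n) C → Sat β C → SatLin β (norm C)
Sat⇒SatLin-norm β (ts ≥ᵖᵇ d) sat with normTerms ts | lhs≡dot-normTerms β ts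
... | v , k | eq = d≤x+k⇒d-k≤x k (subst (d ≤_) eq sat)

SatLin-norm⇒Sat : ∀ {n} (β : Assignment n) C → SatLin β (norm C) → Sat β C
SatLin-norm⇒Sat β (ts ≥ᵖᵇ d) sat with normTerms ts | lhs≡dot-normTerms β ts
... | v , k | eq = subst (d ≤_) (sym eq) (d-k≤x⇒d≤x+k k sat)

ceilDiv-≤ : ∀ r t c .{{_ : ℕ.NonZero c}} → r ≤ + c * t → ceilDiv r c ≤ t
ceilDiv-≤ r t c r≤ct with - t ≤? (- r) /ℕ c
... | yes -t≤q = subst (- ((- r) /ℕ c) ≤_) (neg-involutive t) (neg-mono-≤ -t≤q)
... | no  -t≰q = contradiction r≤ct (<⇒≱ ct<r)
  where
  q = (- r) /ℕ c
  -ct≡-t*c : - (+ c * t) ≡ - t * + c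
  -ct≡-t*c = trans (neg-distribʳ-* (+ c) t) (*-comm (+ c) (- t))
  -r<-ct : - r < - (+ c * t)
  -r<-ct = <-≤-trans (n<s[n/ℕd]*d (- r) c)
             (subst (Data.Integer.suc q * + c ≤_) (sym -ct≡-t*c)
                    (*-monoʳ-≤-nonNeg (+ c) (i<j⇒suc[i]≤j (≰⇒> -t≰q))))
  ct<r : + c * t < r
  ct<r = neg-cancel-< -r<-ct

CP-sound : ∀ {n} (β : Assignment n) {F L} → SatF β F → CP F L → SatLin β L
CP-sound β satF (axiom {C} C∈F) = Sat⇒SatLin-norm β C (All.lookup satF C∈F)
CP-sound β satF (litPos x) =
  subst (0ℤ ≤_) (sym (trans (dot-unit x 1ℤ β) (*-identityˡ _))) (0≤b2z (β x))
CP-sound β satF (litNeg x) = subst (-1ℤ ≤_) (sym (dot-unit x -1ℤ β)) (-1≤-b2z (β x))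
CP-sound β satF (add {L} {M} p q) =
  subst (rhs L + rhs M ≤_) (sym (dot-zipWith-+ (coeffs L) (coeffs M) β))
        (+-mono-≤ (CP-sound β satF p) (CP-sound β satF q))
CP-sound β satF (mul {L} c p) =
  subst (+ c * rhs L ≤_) (sym (dot-map-* (+ c) (coeffs L) β))
        (*-monoˡ-≤-nonNeg (+ c) (CP-sound β satF p))
CP-sound β satF (div {L} c g L≡cg p) = ceilDiv-≤ (rhs L) (dot g β) c
  (subst (rhs L ≤_) (trans (cong (λ v → dot v β) L≡cg) (dot-map-* (+ c) g β))
         (CP-sound β satF p))

⊢-sound : ∀ {n} (β : Assignment n) {F G} → SatF β F → F ⊢ G → SatF β G
⊢-sound β satF [] = []
⊢-sound β satF (_∷_ {C} (d , rhs≤d , cp) F⊢G) =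
  SatLin-norm⇒Sat β C (≤-trans rhs≤d (CP-sound β satF cp)) ∷ ⊢-sound β satF F⊢G

evalLit-negLit : ∀ {n} (β : Assignment n) ℓ → evalLit β (negLit ℓ) ≡ 1ℤ - evalLit β ℓ
evalLit-negLit β (pos x) = refl
evalLit-negLit β (neg x) = involutive (b2z (β x))
  where
  involutive : ∀ b → b ≡ 1ℤ - (1ℤ - b)
  involutive = solve-∀

lhs-negTerms : ∀ {n} (β : Assignment n) ts → lhs β (negTerms ts) ≡ sumCoeffs ts - lhs β ts
lhs-negTerms β []             = refl
lhs-negTerms β ((a , ℓ) ∷ ts) = begin
  a * evalLit β (negLit ℓ) + lhs β (negTerms ts)
    ≡⟨ cong₂ _+_ (cong (a *_) (evalLit-negLit β ℓ)) (lhs-negTerms β ts) ⟩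
  a * (1ℤ - evalLit β ℓ) + (sumCoeffs ts - lhs β ts)
    ≡⟨ rearrange a (evalLit β ℓ) (sumCoeffs ts) (lhs β ts) ⟩
  (a + sumCoeffs ts) - (a * evalLit β ℓ + lhs β ts) ∎
  where
  rearrange : ∀ a b s l → a * (1ℤ - b) + (s - l) ≡ (a + s) - (a * b + l)
  rearrange = solve-∀

¬Sat⇒Sat-negPB : ∀ {n} (β : Assignment n) C → ¬ Sat β C → Sat β (negPB C)
¬Sat⇒Sat-negPB β (ts ≥ᵖᵇ d) ¬sat =
  subst (sumCoeffs ts - d + 1ℤ ≤_) (trans (rearrange (sumCoeffs ts) (lhs β ts))
                                          (sym (lhs-negTerms β ts)))
        (+-monoˡ-≤ 1ℤ (+-monoʳ-≤ (sumCoeffs ts) (neg-mono-≤ 1+lhs≤d)))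
  where
  1+lhs≤d : 1ℤ + lhs β ts ≤ d
  1+lhs≤d = i<j⇒suc[i]≤j (≰⇒> ¬sat)
  rearrange : ∀ s l → s - (1ℤ + l) + 1ℤ ≡ s - l
  rearrange = solve-∀

evalVal : ∀ {n} → Assignment n → Val n → Bool
evalVal β (const b)     = b
evalVal β (lit (pos x)) = β x
evalVal β (lit (neg x)) = not (β x)

_∘ˢ_ : ∀ {n} → Assignment n → Subst n → Assignment n
(β ∘ˢ ω) x = evalVal β (ω x)

b2z-evalVal-notVal : ∀ {n} (β : Assignment n) v →
                     b2z (evalVal β (notVal v)) ≡ 1ℤ - b2z (evalVal β v)
b2z-evalVal-notVal β (const true)  = refl
b2z-evalVal-notVal β (const false) = refl
b2z-evalVal-notVal β (lit (pos x)) = b2z-not (β x)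
b2z-evalVal-notVal β (lit (neg x)) =
  trans (cong b2z (sym (not-involutive (β x)))) (b2z-not (not (β x)))

evalLit-∘ˢ : ∀ {n} (β : Assignment n) ω ℓ →
             evalLit (β ∘ˢ ω) ℓ ≡ b2z (evalVal β (substLit ω ℓ))
evalLit-∘ˢ β ω (pos x) = refl
evalLit-∘ˢ β ω (neg x) = sym (b2z-evalVal-notVal β (ω x))

b2z-evalVal-lit : ∀ {n} (β : Assignment n) ℓ → b2z (evalVal β (lit ℓ)) ≡ evalLit β ℓ
b2z-evalVal-lit β (pos x) = refl
b2z-evalVal-lit β (neg x) = b2z-not (β x)

lhs-∘ˢ : ∀ {n} (β : Assignment n) ω ts →
         lhs (β ∘ˢ ω) ts ≡ lhs β (proj₁ (substTerms ω ts)) + proj₂ (substTerms ω ts)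
lhs-∘ˢ β ω [] = refl
lhs-∘ˢ β ω ((a , ℓ) ∷ ts)
  with substTerms ω ts | substLit ω ℓ | lhs-∘ˢ β ω ts | evalLit-∘ˢ β ω ℓ
... | ts' , k | const true  | ih | eℓ =
  trans (cong₂ _+_ (cong (a *_) eℓ) ih) (rearrange a (lhs β ts') k)
  where
  rearrange : ∀ a l k → a * 1ℤ + (l + k) ≡ l + (a + k)
  rearrange = solve-∀
... | ts' , k | const false | ih | eℓ =
  trans (cong₂ _+_ (cong (a *_) eℓ) ih) (rearrange a (lhs β ts') k)
  where
  rearrange : ∀ a l k → a * 0ℤ + (l + k) ≡ l + k
  rearrange = solve-∀
... | ts' , k | lit ℓ'      | ih | eℓ =
  trans (cong₂ _+_ (cong (a *_) (trans eℓ (b2z-evalVal-lit β ℓ'))) ih)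
        (sym (+-assoc (a * evalLit β ℓ') (lhs β ts') k))

Sat-substPB⇒Sat-∘ˢ : ∀ {n} (β : Assignment n) ω C → Sat β (substPB ω C) → Sat (β ∘ˢ ω) C
Sat-substPB⇒Sat-∘ˢ β ω (ts ≥ᵖᵇ d) sat with substTerms ω ts | lhs-∘ˢ β ω ts
... | ts' , k | eq = subst (d ≤_) (sym eq) (d-k≤x⇒d≤x+k k sat)

SatF-substF⇒SatF-∘ˢ : ∀ {n} (β : Assignment n) ω F → SatF β (substF ω F) → SatF (β ∘ˢ ω) F
SatF-substF⇒SatF-∘ˢ β ω []      []           = []
SatF-substF⇒SatF-∘ˢ β ω (C ∷ F) (sat ∷ sats) =
  Sat-substPB⇒Sat-∘ˢ β ω C sat ∷ SatF-substF⇒SatF-∘ˢ β ω F sats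

AgreeOutside : ∀ {n} → Subset n → Assignment n → Assignment n → Set
AgreeOutside A β α = ∀ x → x ∉ A → β x ≡ α x

∘ˢ-agreeOutside : ∀ {n} {A : Subset n} {ω β α} →
                  SuppIn ω A → AgreeOutside A β α → AgreeOutside A (β ∘ˢ ω) α
∘ˢ-agreeOutside {β = β} supp agree x x∉A = trans (cong (evalVal β) (supp x x∉A)) (agree x x∉A)

ExtendsOutside : ∀ {n} → Subset n → Formula n → Assignment n → Set
ExtendsOutside {n} A F α = Σ (Assignment n) λ β → SatF β F × AgreeOutside A β α

redundance-extendsOutside :
  ∀ {n} {A : Subset n} {α} P C (ω : Subst n) → SuppIn ω A →
  (P ++ negPB C ∷ []) ⊢ substF ω (P ++ C ∷ []) →
  ExtendsOutside A P α → ExtendsOutside A (P ++ C ∷ []) α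
redundance-extendsOutside P C ω supp derivation (β , satP , agree)
  with degree C ≤? lhs β (terms C)
... | yes satC = β , ++⁺ satP (satC ∷ []) , agree
... | no ¬satC =
  β ∘ˢ ω ,
  SatF-substF⇒SatF-∘ˢ β ω (P ++ C ∷ [])
    (⊢-sound β (++⁺ satP (¬Sat⇒Sat-negPB β C ¬satC ∷ [])) derivation) ,
  ∘ˢ-agreeOutside supp agree

extendsOutside-take-suc :
  ∀ {n} {A : Subset n} {S} {α} → IsSpecification S A → (i : Fin (length S)) →
  ExtendsOutside A (take (toℕ i) S) α → ExtendsOutside A (take (ℕ.suc (toℕ i)) S) α
extendsOutside-take-suc {S = S} spec i ext with spec i
... | ω , supp , derivation rewrite take-suc S i =
  redundance-extendsOutside (take (toℕ i) S) (lookup S i) ω supp derivation ext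

specification-extendsOutside-take :
  ∀ {n} {A : Subset n} {S} → IsSpecification S A → ∀ α k → k ℕ.≤ length S →
  ExtendsOutside A (take k S) α
specification-extendsOutside-take spec α ℕ.zero    _ = α , [] , λ _ _ → refl
specification-extendsOutside-take spec α (ℕ.suc k) k<∣S∣
  with extendsOutside-take-suc spec (fromℕ< k<∣S∣)
... | step rewrite toℕ-fromℕ< k<∣S∣ =
  step (specification-extendsOutside-take spec α k (ℕ.<⇒≤ k<∣S∣))

lemma1 : (n : ℕ) (A : Subset n) (S : Formula n) →
    IsSpecification S A →
    (α : Assignment n) →
    Σ (Assignment n) λ β → SatF β S × (∀ x → x ∉ A → β x ≡ α x)
lemma1 n A S spec α =
  subst (λ F → ExtendsOutside A F α) (take-all (length S) S ℕ.≤-refl)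
    (specification-extendsOutside-take spec α (length S) ℕ.≤-refl)
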